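{- Let $m$ be a positive integer. If $m=2^i-1$ for some integer $i\ge1$, then $f_0(2m+2)-f_0(2m)=i$. Otherwise, if the binary expansion of $m$ ends with exactly $i$ ones (i.e. ends with a $0$ followed by $i$ ones, $i\ge0$), then $f_0(2m+2)-f_0(2m)=i+1$.
   Context: Unlabeled chip-firing on the infinite rooted binary tree (every vertex has a left and a right child) with a self-loop at the root. Start with $N$ indistinguishable chips at the root. A vertex with at least $3$ chips may fire, sending one chip to each child and one to its parent (the root keeps that chip via its self-loop). The process reaches a unique stable configuration, and the number of times each vertex fires is independent of the order of fires. $f_0(N)$ denotes the number of times the root fires when starting with $N$ chips. -}

module Defs where

open import Data.Nat using (ℕ; zero; suc; _+_; _*_; _∸_; _<_; _≤_)
open import Data.Bool using (Bool; true; false)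
import Data.Bool as B
open import Data.List using (List; []; _∷_)
open import Data.List.Properties using (≡-dec)
open import Data.Product using (Σ; _×_; _,_; ∃)
open import Relation.Nullary using (does)
open import Relation.Binary.PropositionalEquality using (_≡_)
open import Relation.Binary.Definitions using (DecidableEquality)

-- Vertices of the infinite rooted binary tree: the path from the root,
-- stored in REVERSE order (head = last step).  The root is [];
-- the children of v are false ∷ v (left) and true ∷ v (right);
-- the parent of b ∷ v is v.
Vertex : Set
Vertex = List Bool

_≟ᵥ_ : DecidableEquality Vertex
_≟ᵥ_ = ≡-dec B._≟_

Config : Set
Config = Vertex → ℕ

ind : Bool → ℕ
ind true  = 1
ind false = 0

δ : Vertex → Vertex → ℕ
δ w v = ind (does (w ≟ᵥ v))

-- chips received by w from the parent side when v fires
-- (the root sends its "parent" chip to itself via the self-loop)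
toParent : Vertex → Vertex → ℕ
toParent []      w = δ w []
toParent (_ ∷ p) w = δ w p

gain : Vertex → Vertex → ℕ
gain v w = δ w (false ∷ v) + δ w (true ∷ v) + toParent v w

fire : Vertex → Config → Config
fire v c w = (c w + gain v w) ∸ 3 * δ w v

Stable : Config → Set
Stable c = ∀ v → c v < 3

data Run : Config → ℕ → Config → Set where
  done : ∀ {c} → Run c 0 c
  step : ∀ {c k c'} (v : Vertex) → 3 ≤ c v → Run (fire v c) k c' → Run c (δ v [] + k) c'

init : ℕ → Config
init N w = N * δ w []

-- RootFires N k : starting from N chips at the root, some legal firing
-- sequence reaching a stable configuration fires the root k times
-- (i.e. f₀(N) = k, the value being order independent).
RootFires : ℕ → ℕ → Set
RootFires N k = Σ Config λ c' → Run (init N) k c' × Stable c'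

DiffIs : ℕ → ℕ → Set
DiffIs m d =
  (∃ λ a → ∃ λ b → RootFires (2 * m + 2) a × RootFires (2 * m) b × a ≡ b + d)
  × (∀ a b → RootFires (2 * m + 2) a → RootFires (2 * m) b → a ≡ b + d)

-- Firings commute, so by the least action principle all legal firing sequences that reach a
-- stable configuration fire the root equally often, and it suffices to exhibit one.  Add the
-- chips one at a time and fire whole levels at once: the configurations then depend only on
-- depth, and the stable ones hold 1 or 2 chips per vertex on the first few levels, which is the
-- bijective base-2 numeral (digits 1 and 2, least significant at the root) of the number of
-- chips.  Adding a chip increments this numeral, and every carry past a digit 2 makes the
-- levels above it topple one after another down to the root, which fires exactly once.  Hence
-- f₀(n+1) − f₀(n) is the number of trailing 2s of n, and f₀(2m+2) − f₀(2m) = 1 + (number of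
-- trailing 2s of m − 1).  If m = 2^i − 1 then m − 1 is the numeral of i − 1 twos; if m ends in a
-- 0 followed by i binary ones, the numeral of m − 1 ends in a 1 followed by i twos.
module Submission where

open import Defs
open import Data.Nat using (ℕ; zero; suc; pred; _+_; _*_; _∸_; _^_; _≤_; _<_; z≤n; s≤s)
open import Data.Nat.Properties
open import Algebra.Properties.CommutativeSemigroup +-commutativeSemigroup
  using (x∙yz≈y∙xz; x∙yz≈xz∙y; xy∙z≈xz∙y)
open import Algebra.Properties.CommutativeSemigroup *-commutativeSemigroup
  using () renaming (x∙yz≈y∙xz to *-x∙yz≈y∙xz)
open import Data.Nat.Solver using (module +-*-Solver)
open +-*-Solver using (solve; _:+_; _:*_; _:=_; con)
open import Data.Bool using (Bool; true; false)
open import Data.List using (List; []; _∷_; _++_; length)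
open import Data.Product using (_×_; _,_; proj₁; proj₂; ∃; ∃₂)
open import Data.Sum using (_⊎_; inj₁; inj₂)
open import Data.Unit using (⊤; tt)
open import Function using (_∘_)
open import Relation.Nullary using (Dec; yes; no; contradiction)
open import Relation.Nullary.Decidable using (dec-true; dec-false)
open import Relation.Binary.PropositionalEquality

δ-refl : ∀ v → δ v v ≡ 1
δ-refl v = cong ind (dec-true (v ≟ᵥ v) refl)

δ-≢ : ∀ {w v} → w ≢ v → δ w v ≡ 0
δ-≢ {w} {v} w≢v = cong ind (dec-false (w ≟ᵥ v) w≢v)

δ≡0⇒≢ : ∀ {w v} → δ w v ≡ 0 → w ≢ v
δ≡0⇒≢ {w} δ≡0 refl with trans (sym (δ-refl w)) δ≡0
... | ()

δ-sym : ∀ w v → δ w v ≡ δ v w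
δ-sym w v = by-cases (w ≟ᵥ v)
  where
  by-cases : Dec (w ≡ v) → δ w v ≡ δ v w
  by-cases (yes refl) = refl
  by-cases (no w≢v)   = trans (δ-≢ w≢v) (sym (δ-≢ (w≢v ∘ sym)))

δᴺ : ℕ → ℕ → ℕ
δᴺ zero    zero    = 1
δᴺ zero    (suc _) = 0
δᴺ (suc _) zero    = 0
δᴺ (suc i) (suc j) = δᴺ i j

δᴺ≤1 : ∀ i j → δᴺ i j ≤ 1
δᴺ≤1 zero    zero    = ≤-refl
δᴺ≤1 zero    (suc j) = z≤n
δᴺ≤1 (suc i) zero    = z≤n
δᴺ≤1 (suc i) (suc j) = δᴺ≤1 i j

δᴺ≥1⇒≡ : ∀ i j → 1 ≤ δᴺ i j → i ≡ j
δᴺ≥1⇒≡ zero    zero    _   = refl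
δᴺ≥1⇒≡ (suc i) (suc j) 1≤δ = cong suc (δᴺ≥1⇒≡ i j 1≤δ)

δ-root : ∀ w → δ w [] ≡ δᴺ (length w) 0
δ-root []      = refl
δ-root (_ ∷ _) = refl

sumBy : (Vertex → ℕ) → List Vertex → ℕ
sumBy f []       = 0
sumBy f (v ∷ vs) = f v + sumBy f vs

sumBy-++ : ∀ f us vs → sumBy f (us ++ vs) ≡ sumBy f us + sumBy f vs
sumBy-++ f []       vs = refl
sumBy-++ f (u ∷ us) vs = trans (cong (f u +_) (sumBy-++ f us vs)) (sym (+-assoc (f u) _ _))

sumBy-cong : ∀ {f g} → f ≗ g → ∀ vs → sumBy f vs ≡ sumBy g vs
sumBy-cong f≗g []       = refl
sumBy-cong f≗g (v ∷ vs) = cong₂ _+_ (f≗g v) (sumBy-cong f≗g vs)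

sumBy-+ : ∀ f g vs → sumBy (λ v → f v + g v) vs ≡ sumBy f vs + sumBy g vs
sumBy-+ f g []       = refl
sumBy-+ f g (v ∷ vs) = begin
  f v + g v + sumBy (λ v → f v + g v) vs  ≡⟨ cong (f v + g v +_) (sumBy-+ f g vs) ⟩
  f v + g v + (sumBy f vs + sumBy g vs)   ≡⟨ +-assoc (f v) (g v) _ ⟩
  f v + (g v + (sumBy f vs + sumBy g vs)) ≡⟨ cong (f v +_) (x∙yz≈y∙xz (g v) (sumBy f vs) _) ⟩
  f v + (sumBy f vs + (g v + sumBy g vs)) ≡⟨ +-assoc (f v) _ _ ⟨
  f v + sumBy f vs + (g v + sumBy g vs)   ∎
  where open ≡-Reasoning

sumBy-0 : ∀ vs → sumBy (λ _ → 0) vs ≡ 0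
sumBy-0 []       = refl
sumBy-0 (_ ∷ vs) = sumBy-0 vs

fireCount : Vertex → List Vertex → ℕ
fireCount u = sumBy (λ v → δ v u)

fireSeq : Config → List Vertex → Config
fireSeq c []       = c
fireSeq c (v ∷ vs) = fireSeq (fire v c) vs

Legal : Config → List Vertex → Set
Legal c []       = ⊤
Legal c (v ∷ vs) = 3 ≤ c v × Legal (fire v c) vs

fire-cong : ∀ v {c d} → c ≗ d → fire v c ≗ fire v d
fire-cong v c≗d w = cong (λ x → (x + gain v w) ∸ 3 * δ w v) (c≗d w)

fireSeq-cong : ∀ vs {c d} → c ≗ d → fireSeq c vs ≗ fireSeq d vs
fireSeq-cong []       c≗d = c≗d
fireSeq-cong (v ∷ vs) c≗d = fireSeq-cong vs (fire-cong v c≗d)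

Legal-cong : ∀ vs {c d} → c ≗ d → Legal c vs → Legal d vs
Legal-cong []       c≗d _          = tt
Legal-cong (v ∷ vs) c≗d (3≤cv , l) =
  subst (3 ≤_) (c≗d v) 3≤cv , Legal-cong vs (fire-cong v c≗d) l

fireSeq-++ : ∀ us vs c → fireSeq c (us ++ vs) ≡ fireSeq (fireSeq c us) vs
fireSeq-++ []       vs c = refl
fireSeq-++ (u ∷ us) vs c = fireSeq-++ us vs (fire u c)

Legal-++ : ∀ us vs c → Legal c us → Legal (fireSeq c us) vs → Legal c (us ++ vs)
Legal-++ []       vs c _          l′ = l′
Legal-++ (u ∷ us) vs c (3≤cu , l) l′ = 3≤cu , Legal-++ us vs (fire u c) l l′

Legal-++⁻ : ∀ us vs c → Legal c (us ++ vs) → Legal c us × Legal (fireSeq c us) vs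
Legal-++⁻ []       vs c l          = tt , l
Legal-++⁻ (u ∷ us) vs c (3≤cu , l) =
  let lus , lvs = Legal-++⁻ us vs (fire u c) l in (3≤cu , lus) , lvs

fire-other : ∀ {w v} c → w ≢ v → fire v c w ≡ c w + gain v w
fire-other {w} {v} c w≢v = cong (λ x → (c w + gain v w) ∸ 3 * x) (δ-≢ w≢v)

fire-≥ : ∀ {w v} c → w ≢ v → c w ≤ fire v c w
fire-≥ c w≢v = ≤-trans (m≤m+n _ _) (≤-reflexive (sym (fire-other c w≢v)))

-- With enough chips at v the truncated subtraction in fire is exact.
fire-balance : ∀ v c → 3 ≤ c v → ∀ w → fire v c w + 3 * δ w v ≡ c w + gain v w
fire-balance v c 3≤cv w = m∸n+n≡m (lost≤ (w ≟ᵥ v))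
  where
  lost≤ : Dec (w ≡ v) → 3 * δ w v ≤ c w + gain v w
  lost≤ (yes refl) =
    subst (λ x → 3 * x ≤ c v + gain v v) (sym (δ-refl v)) (≤-trans 3≤cv (m≤m+n _ _))
  lost≤ (no w≢v)   = subst (λ x → 3 * x ≤ c w + gain v w) (sym (δ-≢ w≢v)) z≤n

fireSeq-balance : ∀ vs c → Legal c vs → ∀ w →
  fireSeq c vs w + 3 * fireCount w vs ≡ c w + sumBy (λ v → gain v w) vs
fireSeq-balance []       c _          w = refl
fireSeq-balance (v ∷ vs) c (3≤cv , l) w = begin
  after + 3 * (δ v w + fireCount w vs)     ≡⟨ cong (after +_) (*-distribˡ-+ 3 (δ v w) _) ⟩
  after + (3 * δ v w + 3 * fireCount w vs) ≡⟨ x∙yz≈xz∙y after _ _ ⟩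
  after + 3 * fireCount w vs + 3 * δ v w
    ≡⟨ cong₂ _+_ (fireSeq-balance vs (fire v c) l w) (cong (3 *_) (δ-sym v w)) ⟩
  fire v c w + gains + 3 * δ w v           ≡⟨ xy∙z≈xz∙y (fire v c w) gains _ ⟩
  fire v c w + 3 * δ w v + gains           ≡⟨ cong (_+ gains) (fire-balance v c 3≤cv w) ⟩
  c w + gain v w + gains                   ≡⟨ +-assoc (c w) _ _ ⟩
  c w + (gain v w + gains)                 ∎
  where
  open ≡-Reasoning
  after = fireSeq (fire v c) vs w
  gains = sumBy (λ v → gain v w) vs

-- Both orders fire the same vertices and collect the same gains, so fireSeq-balance
-- identifies the results.
fire-comm : ∀ {u v} c → u ≢ v → 3 ≤ c u → 3 ≤ c v → fire v (fire u c) ≗ fire u (fire v c)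
fire-comm {u} {v} c u≢v 3≤cu 3≤cv w = +-cancelʳ-≡ (3 * fireCount w uv) _ _ (begin
  fireSeq c uv w + 3 * fireCount w uv ≡⟨ fireSeq-balance uv c legal-uv w ⟩
  c w + (gain u w + (gain v w + 0))   ≡⟨ cong (c w +_) (x∙yz≈y∙xz (gain u w) (gain v w) 0) ⟩
  c w + (gain v w + (gain u w + 0))   ≡⟨ fireSeq-balance vu c legal-vu w ⟨
  fireSeq c vu w + 3 * fireCount w vu
    ≡⟨ cong (λ n → fireSeq c vu w + 3 * n) (x∙yz≈y∙xz (δ v w) (δ u w) 0) ⟩
  fireSeq c vu w + 3 * fireCount w uv ∎)
  where
  open ≡-Reasoning
  uv = u ∷ v ∷ []
  vu = v ∷ u ∷ []
  legal-uv : Legal c uv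
  legal-uv = 3≤cu , ≤-trans 3≤cv (fire-≥ c (u≢v ∘ sym)) , tt
  legal-vu : Legal c vu
  legal-vu = 3≤cv , ≤-trans 3≤cu (fire-≥ c u≢v) , tt

fireSeq-≥ : ∀ vs c v → fireCount v vs ≡ 0 → c v ≤ fireSeq c vs v
fireSeq-≥ []       c v _       = ≤-refl
fireSeq-≥ (u ∷ vs) c v count≡0 =
  ≤-trans (fire-≥ c (δ≡0⇒≢ (m+n≡0⇒m≡0 (δ u v) count≡0) ∘ sym))
          (fireSeq-≥ vs (fire u c) v (m+n≡0⇒n≡0 (δ u v) count≡0))

fire-fireSeq-comm : ∀ vs c v → fireCount v vs ≡ 0 → 3 ≤ c v → Legal c vs →
  Legal (fire v c) vs × fireSeq (fire v c) vs ≗ fire v (fireSeq c vs)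
fire-fireSeq-comm []       c v _       _    _          = tt , λ _ → refl
fire-fireSeq-comm (u ∷ vs) c v count≡0 3≤cv (3≤cu , l) =
  (≤-trans 3≤cu (fire-≥ c u≢v) , Legal-cong vs (fire-comm c u≢v 3≤cu 3≤cv) (proj₁ rest)) ,
  λ w → trans (sym (fireSeq-cong vs (fire-comm c u≢v 3≤cu 3≤cv) w)) (proj₂ rest w)
  where
  u≢v : u ≢ v
  u≢v = δ≡0⇒≢ (m+n≡0⇒m≡0 (δ u v) count≡0)
  rest = fire-fireSeq-comm vs (fire u c) v (m+n≡0⇒n≡0 (δ u v) count≡0)
           (≤-trans 3≤cv (fire-≥ c (u≢v ∘ sym))) l

SplitsAtFirst : Vertex → List Vertex → Set
SplitsAtFirst v vs = ∃₂ λ us ws → vs ≡ us ++ v ∷ ws × fireCount v us ≡ 0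

first-occurrence : ∀ v vs → fireCount v vs ≡ 0 ⊎ SplitsAtFirst v vs
first-occurrence v []       = inj₁ refl
first-occurrence v (u ∷ vs) = by-cases (u ≟ᵥ v) (first-occurrence v vs)
  where
  by-cases : Dec (u ≡ v) → fireCount v vs ≡ 0 ⊎ SplitsAtFirst v vs →
             fireCount v (u ∷ vs) ≡ 0 ⊎ SplitsAtFirst v (u ∷ vs)
  by-cases (yes refl) _                                 = inj₂ ([] , vs , refl , refl)
  by-cases (no u≢v)   (inj₁ count≡0)                    =
    inj₁ (trans (cong (_+ _) (δ-≢ u≢v)) count≡0)
  by-cases (no u≢v)   (inj₂ (us , ws , refl , count≡0)) =
    inj₂ (u ∷ us , ws , refl , trans (cong (_+ _) (δ-≢ u≢v)) count≡0)

-- The first firing v of α also occurs in β, since β stabilises; moving its first occurrence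
-- to the front keeps β legal and its end configuration, so induction applies to fire v c.
leastAction : ∀ α c β → Legal c α → Legal c β → Stable (fireSeq c β) →
  ∀ u → fireCount u α ≤ fireCount u β
leastAction []      c β _           _  _  u = z≤n
leastAction (v ∷ α) c β (3≤cv , lα) lβ st u with first-occurrence v β
... | inj₁ count≡0 = contradiction (≤-trans 3≤cv (fireSeq-≥ β c v count≡0)) (<⇒≱ (st v))
... | inj₂ (us , ws , refl , count≡0) = begin
  δ v u + fireCount u α
    ≤⟨ +-monoʳ-≤ (δ v u) (leastAction α (fire v c) (us ++ ws) lα lβ′ st′ u) ⟩
  δ v u + fireCount u (us ++ ws)            ≡⟨ cong (δ v u +_) (sumBy-++ _ us ws) ⟩
  δ v u + (fireCount u us + fireCount u ws) ≡⟨ x∙yz≈y∙xz (δ v u) (fireCount u us) _ ⟩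
  fireCount u us + fireCount u (v ∷ ws)     ≡⟨ sumBy-++ _ us (v ∷ ws) ⟨
  fireCount u (us ++ v ∷ ws)                ∎
  where
  open ≤-Reasoning
  split = Legal-++⁻ us (v ∷ ws) c lβ
  moved = fire-fireSeq-comm us c v count≡0 3≤cv (proj₁ split)
  lβ′ : Legal (fire v c) (us ++ ws)
  lβ′ = Legal-++ us ws (fire v c) (proj₁ moved)
          (Legal-cong ws (λ w → sym (proj₂ moved w)) (proj₂ (proj₂ split)))
  same-end : fireSeq (fire v c) (us ++ ws) ≗ fireSeq c (us ++ v ∷ ws)
  same-end w = begin-equality
    fireSeq (fire v c) (us ++ ws) w       ≡⟨ cong (λ d → d w) (fireSeq-++ us ws (fire v c)) ⟩
    fireSeq (fireSeq (fire v c) us) ws w  ≡⟨ fireSeq-cong ws (proj₂ moved) w ⟩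
    fireSeq (fire v (fireSeq c us)) ws w  ≡⟨ cong (λ d → d w) (fireSeq-++ us (v ∷ ws) c) ⟨
    fireSeq c (us ++ v ∷ ws) w            ∎
  st′ : Stable (fireSeq (fire v c) (us ++ ws))
  st′ w = subst (_< 3) (sym (same-end w)) (st w)

Run⇒Legal : ∀ {c k c′} → Run c k c′ →
  ∃ λ vs → Legal c vs × k ≡ fireCount [] vs × fireSeq c vs ≡ c′
Run⇒Legal done            = [] , tt , refl , refl
Run⇒Legal (step v 3≤cv r) =
  let vs , l , k≡ , end≡ = Run⇒Legal r in v ∷ vs , (3≤cv , l) , cong (δ v [] +_) k≡ , end≡

Legal⇒Run : ∀ vs c → Legal c vs → Run c (fireCount [] vs) (fireSeq c vs)
Legal⇒Run []       c _          = done
Legal⇒Run (v ∷ vs) c (3≤cv , l) = step v 3≤cv (Legal⇒Run vs (fire v c) l)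

stableRuns-sameRootCount : ∀ {c k k′ c′ c″} →
  Run c k c′ → Stable c′ → Run c k′ c″ → Stable c″ → k ≡ k′
stableRuns-sameRootCount r st r′ st′ with Run⇒Legal r | Run⇒Legal r′
... | vs , l , refl , refl | vs′ , l′ , refl , refl =
  ≤-antisym (leastAction vs _ vs′ l l′ st′ []) (leastAction vs′ _ vs l′ l st [])

fire-+ : ∀ v c (e : Config) → 3 ≤ c v → fire v (λ x → e x + c x) ≗ λ w → e w + fire v c w
fire-+ v c e 3≤cv w = +-cancelʳ-≡ (3 * δ w v) _ _ (begin
  fire v (λ x → e x + c x) w + 3 * δ w v ≡⟨ fire-balance v (λ x → e x + c x) 3≤ec w ⟩
  e w + c w + gain v w                   ≡⟨ +-assoc (e w) (c w) _ ⟩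
  e w + (c w + gain v w)                 ≡⟨ cong (e w +_) (fire-balance v c 3≤cv w) ⟨
  e w + (fire v c w + 3 * δ w v)         ≡⟨ +-assoc (e w) _ _ ⟨
  e w + fire v c w + 3 * δ w v           ∎)
  where
  open ≡-Reasoning
  3≤ec = ≤-trans 3≤cv (m≤n+m (c v) (e v))

fireSeq-+ : ∀ vs c (e : Config) → Legal c vs →
  Legal (λ x → e x + c x) vs × fireSeq (λ x → e x + c x) vs ≗ λ w → e w + fireSeq c vs w
fireSeq-+ []       c e _          = tt , λ _ → refl
fireSeq-+ (v ∷ vs) c e (3≤cv , l) =
  (≤-trans 3≤cv (m≤n+m _ _) , Legal-cong vs (λ w → sym (fire-+ v c e 3≤cv w)) (proj₁ rest)) ,
  λ w → trans (fireSeq-cong vs (fire-+ v c e 3≤cv) w) (proj₂ rest w)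
  where rest = fireSeq-+ vs (fire v c) e l

Legal-distinct : ∀ vs c → (∀ u → fireCount u vs ≤ 1) →
  (∀ u → 1 ≤ fireCount u vs → 3 ≤ c u) → Legal c vs
Legal-distinct []       c _        _      = tt
Legal-distinct (v ∷ vs) c distinct loaded =
  loaded v v∈ , Legal-distinct vs (fire v c) (λ u → ≤-trans (m≤n+m _ (δ v u)) (distinct u)) loaded′
  where
  v∈ : 1 ≤ fireCount v (v ∷ vs)
  v∈ = subst (λ n → 1 ≤ n + fireCount v vs) (sym (δ-refl v)) (s≤s z≤n)
  loaded′ : ∀ u → 1 ≤ fireCount u vs → 3 ≤ fire v c u
  loaded′ u u∈ = ≤-trans (loaded u (≤-trans u∈ (m≤n+m _ _))) (fire-≥ c u≢v)
    where
    u≢v : u ≢ v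
    u≢v refl = <⇒≱ (subst (λ n → 1 < n + fireCount u vs) (sym (δ-refl u)) (s≤s u∈)) (distinct u)

children : List Vertex → List Vertex
children []       = []
children (p ∷ ps) = (false ∷ p) ∷ (true ∷ p) ∷ children ps

level : ℕ → List Vertex
level zero    = [] ∷ []
level (suc ℓ) = children (level ℓ)

sumBy-children : ∀ f ps → sumBy f (children ps) ≡ sumBy (λ p → f (false ∷ p) + f (true ∷ p)) ps
sumBy-children f []       = refl
sumBy-children f (p ∷ ps) =
  trans (sym (+-assoc (f (false ∷ p)) _ _))
        (cong (f (false ∷ p) + f (true ∷ p) +_) (sumBy-children f ps))

level-count : ∀ ℓ w → sumBy (δ w) (level ℓ) ≡ δᴺ (length w) ℓ
level-count zero    w           = trans (+-identityʳ (δ w [])) (δ-root w)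
level-count (suc ℓ) []          = trans (sumBy-children (δ []) (level ℓ)) (sumBy-0 (level ℓ))
level-count (suc ℓ) (false ∷ w) = begin
  sumBy (δ (false ∷ w)) (children (level ℓ)) ≡⟨ sumBy-children (δ (false ∷ w)) (level ℓ) ⟩
  sumBy (λ p → δ w p + 0) (level ℓ)          ≡⟨ sumBy-cong (λ p → +-identityʳ (δ w p)) (level ℓ) ⟩
  sumBy (δ w) (level ℓ)                      ≡⟨ level-count ℓ w ⟩
  δᴺ (length w) ℓ                            ∎
  where open ≡-Reasoning
level-count (suc ℓ) (true ∷ w)  =
  trans (sumBy-children (δ (true ∷ w)) (level ℓ)) (level-count ℓ w)

fireCount-level : ∀ ℓ w → fireCount w (level ℓ) ≡ δᴺ (length w) ℓ
fireCount-level ℓ w = trans (sumBy-cong (λ v → δ-sym v w) (level ℓ)) (level-count ℓ w)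

-- Chips received at depth j when all of level ℓ fires (the root's chip for its parent
-- returns to the root).
parentGain : ℕ → ℕ → ℕ
parentGain zero    j = δᴺ j 0
parentGain (suc ℓ) j = δᴺ j ℓ + δᴺ j ℓ

levelGain : ℕ → ℕ → ℕ
levelGain ℓ j = δᴺ j (suc ℓ) + parentGain ℓ j

parentGain-level : ∀ ℓ w → sumBy (λ v → toParent v w) (level ℓ) ≡ parentGain ℓ (length w)
parentGain-level zero    w = trans (+-identityʳ (δ w [])) (δ-root w)
parentGain-level (suc ℓ) w = begin
  sumBy (λ v → toParent v w) (children (level ℓ)) ≡⟨ sumBy-children (λ v → toParent v w) (level ℓ) ⟩
  sumBy (λ p → δ w p + δ w p) (level ℓ)           ≡⟨ sumBy-+ (δ w) (δ w) (level ℓ) ⟩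
  sumBy (δ w) (level ℓ) + sumBy (δ w) (level ℓ)   ≡⟨ cong₂ _+_ (level-count ℓ w) (level-count ℓ w) ⟩
  parentGain (suc ℓ) (length w)                   ∎
  where open ≡-Reasoning

gain-level : ∀ ℓ w → sumBy (λ v → gain v w) (level ℓ) ≡ levelGain ℓ (length w)
gain-level ℓ w = begin
  sumBy (λ v → gain v w) (level ℓ)
    ≡⟨ sumBy-+ (λ v → δ w (false ∷ v) + δ w (true ∷ v)) (λ v → toParent v w) (level ℓ) ⟩
  sumBy (λ v → δ w (false ∷ v) + δ w (true ∷ v)) (level ℓ) + toLevel
    ≡⟨ cong (_+ toLevel) (sumBy-children (δ w) (level ℓ)) ⟨
  sumBy (δ w) (level (suc ℓ)) + toLevel
    ≡⟨ cong₂ _+_ (level-count (suc ℓ) w) (parentGain-level ℓ w) ⟩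
  levelGain ℓ (length w) ∎
  where
  open ≡-Reasoning
  toLevel = sumBy (λ v → toParent v w) (level ℓ)

Profile : Set
Profile = ℕ → ℕ

HasProfile : Config → Profile → Set
HasProfile c a = ∀ w → c w ≡ a (length w)

record RadialRun (a : Profile) (k : ℕ) (b : Profile) : Set where
  constructor radialRun
  field
    run : ∀ c → HasProfile c a →
      ∃ λ vs → Legal c vs × fireCount [] vs ≡ k × HasProfile (fireSeq c vs) b

open RadialRun

RadialRun-id : ∀ {a b} → a ≗ b → RadialRun a 0 b
RadialRun-id a≗b = radialRun λ c hc → [] , tt , refl , λ w → trans (hc w) (a≗b _)

RadialRun-respˡ : ∀ {a a′ k b} → a ≗ a′ → RadialRun a′ k b → RadialRun a k b
RadialRun-respˡ a≗a′ r = radialRun λ c hc → run r c (λ w → trans (hc w) (a≗a′ _))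

RadialRun-respʳ : ∀ {a k b b′} → b ≗ b′ → RadialRun a k b → RadialRun a k b′
RadialRun-respʳ b≗b′ r = radialRun λ c hc →
  let vs , l , k≡ , hb = run r c hc in vs , l , k≡ , λ w → trans (hb w) (b≗b′ _)

RadialRun-trans : ∀ {a k b k′ d} → RadialRun a k b → RadialRun b k′ d → RadialRun a (k + k′) d
RadialRun-trans r r′ = radialRun λ c hc →
  let vs  , l  , k≡  , hb = run r c hc
      vs′ , l′ , k′≡ , hd = run r′ (fireSeq c vs) hb
  in vs ++ vs′ , Legal-++ vs vs′ c l l′ ,
     trans (sumBy-++ _ vs vs′) (cong₂ _+_ k≡ k′≡) ,
     λ w → trans (cong (λ d → d w) (fireSeq-++ vs vs′ c)) (hd w)

bump : Profile → Profile
bump a j = δᴺ j 0 + a j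

RadialRun-bump : ∀ {a k b} → RadialRun a k b → RadialRun (bump a) k (bump b)
RadialRun-bump {a} {k} {b} r = radialRun λ c hc →
  let c≗ : c ≗ λ w → δ w [] + c₀ w
      c≗ w = trans (hc w) (cong (_+ c₀ w) (sym (δ-root w)))
      vs , l , k≡ , hb = run r c₀ (λ _ → refl)
      l′ , end≡ = fireSeq-+ vs c₀ (λ w → δ w []) l
  in vs , Legal-cong vs (λ w → sym (c≗ w)) l′ , k≡ ,
     λ w → trans (fireSeq-cong vs c≗ w) (trans (end≡ w) (cong₂ _+_ (δ-root w) (hb w)))
  where
  c₀ : Config
  c₀ w = a (length w)

-- The gain is added first so that the concrete level computations below hold by refl.
levelFire : ℕ → Profile → Profile
levelFire ℓ a j = (levelGain ℓ j + a j) ∸ 3 * δᴺ j ℓ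

fireLevel : ∀ ℓ a → 3 ≤ a ℓ → RadialRun a (δᴺ 0 ℓ) (levelFire ℓ a)
fireLevel ℓ a 3≤aℓ = radialRun λ c hc →
  level ℓ , legal c hc , fireCount-level ℓ [] , profile c hc
  where
  legal : ∀ c → HasProfile c a → Legal c (level ℓ)
  legal c hc = Legal-distinct (level ℓ) c
    (λ u → subst (_≤ 1) (sym (fireCount-level ℓ u)) (δᴺ≤1 (length u) ℓ))
    (λ u u∈ → subst (3 ≤_) (sym (trans (hc u) (cong a (on-level u u∈)))) 3≤aℓ)
    where
    on-level : ∀ u → 1 ≤ fireCount u (level ℓ) → length u ≡ ℓ
    on-level u u∈ = δᴺ≥1⇒≡ (length u) ℓ (subst (1 ≤_) (fireCount-level ℓ u) u∈)
  profile : ∀ c → HasProfile c a → HasProfile (fireSeq c (level ℓ)) (levelFire ℓ a)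
  profile c hc w = begin
    fireSeq c (level ℓ) w                           ≡⟨ m+n∸n≡m _ lost ⟨
    (fireSeq c (level ℓ) w + lost) ∸ lost
      ≡⟨ cong₂ _∸_ (fireSeq-balance (level ℓ) c (legal c hc) w) (cong (3 *_) (fireCount-level ℓ w)) ⟩
    (c w + sumBy (λ v → gain v w) (level ℓ)) ∸ 3 * δᴺ (length w) ℓ
      ≡⟨ cong (_∸ 3 * δᴺ (length w) ℓ) (cong₂ _+_ (hc w) (gain-level ℓ w)) ⟩
    (a (length w) + levelGain ℓ (length w)) ∸ 3 * δᴺ (length w) ℓ
      ≡⟨ cong (_∸ 3 * δᴺ (length w) ℓ) (+-comm (a (length w)) _) ⟩
    levelFire ℓ a (length w)                        ∎
    where
    open ≡-Reasoning
    lost = 3 * fireCount w (level ℓ)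

_◂_ : ℕ → Profile → Profile
(x ◂ a) zero    = x
(x ◂ a) (suc j) = a j

infixr 5 _◂_

◂-cong : ∀ x {a b} → a ≗ b → x ◂ a ≗ x ◂ b
◂-cong x a≗b zero    = refl
◂-cong x a≗b (suc j) = a≗b j

bump-◂ : ∀ x a → bump (x ◂ a) ≗ suc x ◂ a
bump-◂ x a zero    = refl
bump-◂ x a (suc j) = refl

ones : ℕ → Profile → Profile
ones zero    a = a
ones (suc k) a = 1 ◂ ones k a

ones-cong : ∀ k {a b} → a ≗ b → ones k a ≗ ones k b
ones-cong zero    a≗b = a≗b
ones-cong (suc k) a≗b = ◂-cong 1 (ones-cong k a≗b)

ones-suc : ∀ k a → ones (suc k) a ≗ ones k (1 ◂ a)
ones-suc zero    a = λ _ → refl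
ones-suc (suc k) a = ◂-cong 1 (ones-suc k a)

ones-at : ∀ k a → ones k a k ≡ a 0
ones-at zero    a = refl
ones-at (suc k) a = ones-at k a

levelFire-◂ : ∀ ℓ x a → levelFire (2 + ℓ) (x ◂ a) ≗ x ◂ levelFire (1 + ℓ) a
levelFire-◂ ℓ x a zero    = refl
levelFire-◂ ℓ x a (suc j) = refl

levelFire-root : ∀ b → levelFire 0 (3 ◂ b) ≗ 1 ◂ bump b
levelFire-root b zero          = refl
levelFire-root b (suc zero)    = refl
levelFire-root b (suc (suc j)) = refl

levelFire-cascade : ∀ k b → levelFire (suc k) (ones (suc k) (3 ◂ b)) ≗ ones k (3 ◂ 0 ◂ bump b)
levelFire-cascade zero    b zero                = refl
levelFire-cascade zero    b (suc zero)          = refl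
levelFire-cascade zero    b (suc (suc zero))    = refl
levelFire-cascade zero    b (suc (suc (suc j))) = refl
levelFire-cascade (suc k) b j =
  trans (levelFire-◂ k 1 (ones (suc k) (3 ◂ b)) j) (◂-cong 1 (levelFire-cascade k b) j)

-- Firing level k passes the 3 up to level k − 1, and so on down to the root.
cascade : ∀ k b → RadialRun (ones k (3 ◂ b)) 1 (ones (suc k) (bump b))
cascade zero    b = RadialRun-respʳ (levelFire-root b) (fireLevel 0 (3 ◂ b) ≤-refl)
cascade (suc k) b = RadialRun-trans
  (RadialRun-respʳ (levelFire-cascade k b) (fireLevel (suc k) (ones (suc k) (3 ◂ b)) 3≤))
  (RadialRun-respʳ one-more-level (cascade k (0 ◂ bump b)))
  where
  3≤ : 3 ≤ ones (suc k) (3 ◂ b) (suc k)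
  3≤ = ≤-reflexive (sym (ones-at (suc k) (3 ◂ b)))
  one-more-level : ones (suc k) (bump (0 ◂ bump b)) ≗ ones (suc (suc k)) (bump b)
  one-more-level j = trans (ones-cong (suc k) (bump-◂ 0 (bump b)) j) (sym (ones-suc (suc k) (bump b) j))

-- A bijective base-2 numeral, least significant digit first: false is the digit 1, true is 2.
digit : Bool → ℕ
digit false = 1
digit true  = 2

digitProfile : List Bool → Profile
digitProfile []       _ = 0
digitProfile (b ∷ ds)   = digit b ◂ digitProfile ds

digitProfile<3 : ∀ ds j → digitProfile ds j < 3
digitProfile<3 []           j       = s≤s z≤n
digitProfile<3 (false ∷ ds) zero    = s≤s (s≤s z≤n)
digitProfile<3 (true ∷ ds)  zero    = ≤-refl
digitProfile<3 (_ ∷ ds)     (suc j) = digitProfile<3 ds j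

increment : List Bool → List Bool
increment []           = false ∷ []
increment (false ∷ ds) = true ∷ ds
increment (true ∷ ds)  = false ∷ increment ds

trailingTwos : List Bool → ℕ
trailingTwos []          = 0
trailingTwos (false ∷ _) = 0
trailingTwos (true ∷ ds) = suc (trailingTwos ds)

bump-[] : bump (digitProfile []) ≗ digitProfile (false ∷ [])
bump-[] zero    = refl
bump-[] (suc j) = refl

carry : ∀ ds ℓ →
  RadialRun (ones ℓ (bump (digitProfile ds))) (trailingTwos ds) (ones ℓ (digitProfile (increment ds)))
carry []           ℓ = RadialRun-id (ones-cong ℓ bump-[])
carry (false ∷ ds) ℓ = RadialRun-id (ones-cong ℓ (bump-◂ 1 (digitProfile ds)))
carry (true ∷ ds)  ℓ = RadialRun-respˡ (ones-cong ℓ (bump-◂ 2 (digitProfile ds)))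
  (RadialRun-trans (cascade ℓ (digitProfile ds))
    (RadialRun-respʳ (ones-suc ℓ (digitProfile (increment ds))) (carry ds (suc ℓ))))

digits : ℕ → List Bool
digits zero    = []
digits (suc n) = increment (digits n)

f₀ : ℕ → ℕ
f₀ zero    = 0
f₀ (suc n) = f₀ n + trailingTwos (digits n)

rootPile : ℕ → Profile
rootPile n j = n * δᴺ j 0

stabilise : ∀ n → RadialRun (rootPile n) (f₀ n) (digitProfile (digits n))
stabilise zero    = RadialRun-id λ _ → refl
stabilise (suc n) = RadialRun-trans (RadialRun-bump (stabilise n)) (carry (digits n) 0)

rootFires-f₀ : ∀ n → RootFires n (f₀ n)
rootFires-f₀ n =
  let vs , l , count≡ , profile = run (stabilise n) (init n) (λ w → cong (n *_) (δ-root w))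
  in fireSeq (init n) vs ,
     subst (λ k → Run (init n) k (fireSeq (init n) vs)) count≡ (Legal⇒Run vs (init n) l) ,
     λ w → subst (_< 3) (sym (profile w)) (digitProfile<3 (digits n) (length w))

rootFires⇒≡f₀ : ∀ {n k} → RootFires n k → k ≡ f₀ n
rootFires⇒≡f₀ {n} (_ , r , st) =
  let _ , r₀ , st₀ = rootFires-f₀ n in stableRuns-sameRootCount r st r₀ st₀

DiffIs-f₀ : ∀ m d → f₀ (2 * m + 2) ≡ f₀ (2 * m) + d → DiffIs m d
DiffIs-f₀ m d f₀≡ =
  (f₀ (2 * m + 2) , f₀ (2 * m) , rootFires-f₀ (2 * m + 2) , rootFires-f₀ (2 * m) , f₀≡) ,
  λ a b ra rb → begin
    a                  ≡⟨ rootFires⇒≡f₀ {2 * m + 2} ra ⟩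
    f₀ (2 * m + 2)     ≡⟨ f₀≡ ⟩
    f₀ (2 * m) + d     ≡⟨ cong (_+ d) (rootFires⇒≡f₀ {2 * m} rb) ⟨
    b + d              ∎
  where open ≡-Reasoning

digits-odd-even : ∀ n →
  digits (1 + 2 * n) ≡ false ∷ digits n × digits (2 + 2 * n) ≡ true ∷ digits n
digits-odd-even zero    = refl , refl
digits-odd-even (suc n) =
  trans (cong (digits ∘ suc) (*-suc 2 n)) (cong increment even) ,
  trans (cong (digits ∘ suc ∘ suc) (*-suc 2 n)) (cong (increment ∘ increment) even)
  where even = proj₂ (digits-odd-even n)

f₀-double-step : ∀ n → f₀ (2 * suc n + 2) ≡ f₀ (2 * suc n) + suc (trailingTwos (digits n))
f₀-double-step n = begin
  f₀ (2 * suc n + 2)                            ≡⟨ cong f₀ (+-comm (2 * suc n) 2) ⟩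
  f₀ (2 * suc n) + ttEven + ttOdd               ≡⟨ +-assoc (f₀ (2 * suc n)) ttEven ttOdd ⟩
  f₀ (2 * suc n) + (ttEven + ttOdd)             ≡⟨ cong (f₀ (2 * suc n) +_) (cong₂ _+_ even odd) ⟩
  f₀ (2 * suc n) + (suc (trailingTwos (digits n)) + 0)
    ≡⟨ cong (f₀ (2 * suc n) +_) (+-identityʳ _) ⟩
  f₀ (2 * suc n) + suc (trailingTwos (digits n)) ∎
  where
  open ≡-Reasoning
  ttEven = trailingTwos (digits (2 * suc n))
  ttOdd  = trailingTwos (digits (1 + 2 * suc n))
  even : ttEven ≡ suc (trailingTwos (digits n))
  even = cong trailingTwos (trans (cong digits (*-suc 2 n)) (proj₂ (digits-odd-even n)))
  odd : ttOdd ≡ 0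
  odd = cong trailingTwos (proj₁ (digits-odd-even (suc n)))

DiffIs-suc : ∀ n → DiffIs (suc n) (suc (trailingTwos (digits n)))
DiffIs-suc n = DiffIs-f₀ (suc n) _ (f₀-double-step n)

prependTwos : ℕ → ℕ → ℕ
prependTwos zero    n = n
prependTwos (suc i) n = 2 + 2 * prependTwos i n

trailingTwos-prependTwos : ∀ i n →
  trailingTwos (digits (prependTwos i n)) ≡ i + trailingTwos (digits n)
trailingTwos-prependTwos zero    n = refl
trailingTwos-prependTwos (suc i) n =
  trans (cong trailingTwos (proj₂ (digits-odd-even (prependTwos i n))))
        (cong suc (trailingTwos-prependTwos i n))

2+prependTwos : ∀ i n → 2 + prependTwos i n ≡ (2 + n) * 2 ^ i
2+prependTwos zero    n = sym (*-identityʳ (2 + n))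
2+prependTwos (suc i) n = begin
  2 + (2 + 2 * prependTwos i n) ≡⟨ *-distribˡ-+ 2 2 (prependTwos i n) ⟨
  2 * (2 + prependTwos i n)     ≡⟨ cong (2 *_) (2+prependTwos i n) ⟩
  2 * ((2 + n) * 2 ^ i)         ≡⟨ *-x∙yz≈y∙xz 2 (2 + n) (2 ^ i) ⟩
  (2 + n) * 2 ^ suc i           ∎
  where open ≡-Reasoning

2^[1+i]∸1≡prependTwos : ∀ i → 2 ^ suc i ∸ 1 ≡ suc (prependTwos i 0)
2^[1+i]∸1≡prependTwos i = cong pred (sym (2+prependTwos i 0))

[1+q]2^[1+i]+2^i∸1≡prependTwos : ∀ q i →
  suc q * 2 ^ suc i + (2 ^ i ∸ 1) ≡ suc (prependTwos i (1 + 2 * q))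
[1+q]2^[1+i]+2^i∸1≡prependTwos q i = suc-injective (begin
  suc (suc q * 2 ^ suc i + pred (2 ^ i)) ≡⟨ +-suc (suc q * 2 ^ suc i) _ ⟨
  suc q * 2 ^ suc i + suc (pred (2 ^ i))
    ≡⟨ cong (suc q * 2 ^ suc i +_) (suc-pred (2 ^ i) {{m^n≢0 2 i}}) ⟩
  suc q * (2 * 2 ^ i) + 2 ^ i
    ≡⟨ solve 2 (λ q p → (con 1 :+ q) :* (con 2 :* p) :+ p := (con 3 :+ con 2 :* q) :* p) refl q (2 ^ i) ⟩
  (3 + 2 * q) * 2 ^ i                   ≡⟨ 2+prependTwos i (1 + 2 * q) ⟨
  2 + prependTwos i (1 + 2 * q)         ∎)
  where open ≡-Reasoning

-- The hypothesis 1 ≤ m is implied by either case hypothesis.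
mainTheorem17 : (m : ℕ) → 1 ≤ m →
    ((i : ℕ) → 1 ≤ i → m ≡ 2 ^ i ∸ 1 → DiffIs m i)
    × ((i q : ℕ) → 1 ≤ q → m ≡ q * 2 ^ suc i + (2 ^ i ∸ 1) → DiffIs m (i + 1))
mainTheorem17 m _ = allOnes , zeroThenOnes
  where
  allOnes : (i : ℕ) → 1 ≤ i → m ≡ 2 ^ i ∸ 1 → DiffIs m i
  allOnes (suc i) _ m≡ =
    subst₂ DiffIs (sym (trans m≡ (2^[1+i]∸1≡prependTwos i)))
      (cong suc (trans (trailingTwos-prependTwos i 0) (+-identityʳ i)))
      (DiffIs-suc (prependTwos i 0))
  zeroThenOnes : (i q : ℕ) → 1 ≤ q → m ≡ q * 2 ^ suc i + (2 ^ i ∸ 1) → DiffIs m (i + 1)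
  zeroThenOnes i (suc q) _ m≡ =
    subst₂ DiffIs (sym (trans m≡ ([1+q]2^[1+i]+2^i∸1≡prependTwos q i)))
      (trans (cong suc (trans (trailingTwos-prependTwos i (1 + 2 * q)) (cong (i +_) odd)))
             (sym (+-suc i 0)))
      (DiffIs-suc (prependTwos i (1 + 2 * q)))
    where
    odd : trailingTwos (digits (1 + 2 * q)) ≡ 0
    odd = cong trailingTwos (proj₁ (digits-odd-even q))
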